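{- For any integers $m,n\ge 0$, $$\binom{m+n}{m}H_{n+m}=\sum_{k=0}^{n}H_k\binom{m+n-k-1}{n-k}+H_m\binom{n+m}{n},$$ where $H_j$ denotes the $j$-th harmonic number.
   Context: Harmonic numbers: $H_0=0$ and $H_j=1+\frac12+\cdots+\frac1j$ for $j\ge1$. Binomial coefficients are the generalized ones: for any real (or integer, possibly negative) $x$ and integer $j\ge0$, $\binom{x}{j}=\frac{x(x-1)\cdots(x-j+1)}{j!}$, with $\binom{x}{0}=1$ (so e.g. $\binom{ -1}{0}=1$). -}

module Defs where

open import Data.Nat as ℕ using (ℕ; zero; suc)
open import Data.Integer as ℤ using (ℤ; +_)
open import Data.Rational as ℚ using (ℚ; 0ℚ; 1ℚ; _/_; _+_; _*_)

H : ℕ → ℚ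
H zero    = 0ℚ
H (suc j) = H j + (+ 1) / suc j

-- Generalized binomial coefficient binom x j = x(x-1)...(x-j+1)/j!
-- for integer x (possibly negative), with binom x 0 = 1.
-- Recursion: binom x (j+1) = binom x j * (x - j) / (j+1).
binom : ℤ → ℕ → ℚ
binom x zero    = 1ℚ
binom x (suc j) = binom x j * ((x ℤ.- + j) / suc j)

Σ≤ : ℕ → (ℕ → ℚ) → ℚ
Σ≤ zero    f = f 0
Σ≤ (suc n) f = Σ≤ n f + f (suc n)

-- By symmetry C(m+n, m) = C(m+n, n), the identity says that C(m+n, n) (H (m+n) − H m)
-- is the convolution over k ≤ n of H k with the multiset coefficients C(m+d−1, d),
-- d = n − k.  Both sides, as functions of (m, n), obey the Pascal recurrence
-- F (m+1) (n+1) = F m (n+1) + F (m+1) n, and they agree for n = 0 (both vanish) and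
-- for m = 0 (both equal H n, since C(d−1, d) = 0 for d > 0), so they coincide.  For
-- the left side the recurrence reduces, via Pascal's rule, to the absorption identities
-- C(y+1, n+1)/(y+1) = C(y, n)/(n+1) = C(y, n+1)/(m+1), where y = m+n+1.

module Submission where

open import Defs
open import Data.Nat using (ℕ)
open import Data.Integer using (+_; _-_)
open import Data.Rational using (_+_; _*_)
open import Relation.Binary.PropositionalEquality using (_≡_)

open import Data.Nat as ℕ using (zero; suc; _≤_; z≤n)
import Data.Nat.Properties as ℕ
open import Data.Integer as ℤ using (ℤ; 1ℤ)
import Data.Integer.Properties as ℤ
import Data.Integer.Tactic.RingSolver as ℤ-Solver
open import Data.Rational as ℚ using (ℚ; 0ℚ; 1ℚ; _/_; toℚᵘ; fromℚᵘ)
open import Data.Rational.Properties as ℚ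
  using (toℚᵘ-fromℚᵘ; fromℚᵘ-toℚᵘ; fromℚᵘ-cong; toℚᵘ-homo-+; toℚᵘ-homo-*)
open import Data.Rational.Unnormalised as ℚᵘ using (mkℚᵘ; *≡*)
import Data.Rational.Unnormalised.Properties as ℚᵘ
open import Level using (0ℓ)
open import Relation.Binary.PropositionalEquality
open import Relation.Nullary.Decidable using (dec⇒maybe)
import Tactic.RingSolver.Core.AlmostCommutativeRing as ACR
open import Tactic.RingSolver using (solve-∀)

ℚ-ring : ACR.AlmostCommutativeRing 0ℓ 0ℓ
ℚ-ring = ACR.fromCommutativeRing ℚ.+-*-commutativeRing (λ p → dec⇒maybe (0ℚ ℚ.≟ p))

fromℚᵘ-homo-+ : ∀ p q → fromℚᵘ (p ℚᵘ.+ q) ≡ fromℚᵘ p + fromℚᵘ q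
fromℚᵘ-homo-+ p q = begin
  fromℚᵘ (p ℚᵘ.+ q)
    ≡⟨ fromℚᵘ-cong (ℚᵘ.+-cong (ℚᵘ.≃-sym (toℚᵘ-fromℚᵘ p)) (ℚᵘ.≃-sym (toℚᵘ-fromℚᵘ q))) ⟩
  fromℚᵘ (toℚᵘ (fromℚᵘ p) ℚᵘ.+ toℚᵘ (fromℚᵘ q))
    ≡⟨ fromℚᵘ-cong (ℚᵘ.≃-sym (toℚᵘ-homo-+ (fromℚᵘ p) (fromℚᵘ q))) ⟩
  fromℚᵘ (toℚᵘ (fromℚᵘ p + fromℚᵘ q))
    ≡⟨ fromℚᵘ-toℚᵘ (fromℚᵘ p + fromℚᵘ q) ⟩
  fromℚᵘ p + fromℚᵘ q ∎
  where open ≡-Reasoning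

fromℚᵘ-homo-* : ∀ p q → fromℚᵘ (p ℚᵘ.* q) ≡ fromℚᵘ p * fromℚᵘ q
fromℚᵘ-homo-* p q = begin
  fromℚᵘ (p ℚᵘ.* q)
    ≡⟨ fromℚᵘ-cong (ℚᵘ.*-cong (ℚᵘ.≃-sym (toℚᵘ-fromℚᵘ p)) (ℚᵘ.≃-sym (toℚᵘ-fromℚᵘ q))) ⟩
  fromℚᵘ (toℚᵘ (fromℚᵘ p) ℚᵘ.* toℚᵘ (fromℚᵘ q))
    ≡⟨ fromℚᵘ-cong (ℚᵘ.≃-sym (toℚᵘ-homo-* (fromℚᵘ p) (fromℚᵘ q))) ⟩
  fromℚᵘ (toℚᵘ (fromℚᵘ p * fromℚᵘ q))
    ≡⟨ fromℚᵘ-toℚᵘ (fromℚᵘ p * fromℚᵘ q) ⟩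
  fromℚᵘ p * fromℚᵘ q ∎
  where open ≡-Reasoning

infix 8 _/1

_/1 : ℤ → ℚ
i /1 = i / 1

1/[1+_] : ℕ → ℚ
1/[1+ n ] = + 1 / suc n

/1-homo-+ : ∀ i j → (i ℤ.+ j) /1 ≡ i /1 + j /1
/1-homo-+ i j =
  trans (fromℚᵘ-cong {mkℚᵘ (i ℤ.+ j) 0} {mkℚᵘ i 0 ℚᵘ.+ mkℚᵘ j 0} (*≡* cross))
        (fromℚᵘ-homo-+ (mkℚᵘ i 0) (mkℚᵘ j 0))
  where
  cross : (i ℤ.+ j) ℤ.* 1ℤ ≡ (i ℤ.* 1ℤ ℤ.+ j ℤ.* 1ℤ) ℤ.* 1ℤ
  cross = cong (ℤ._* 1ℤ) (sym (cong₂ ℤ._+_ (ℤ.*-identityʳ i) (ℤ.*-identityʳ j)))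

/suc≡/1*1/[1+] : ∀ i n → i / suc n ≡ i /1 * 1/[1+ n ]
/suc≡/1*1/[1+] i n =
  trans (fromℚᵘ-cong {mkℚᵘ i n} {mkℚᵘ i 0 ℚᵘ.* mkℚᵘ 1ℤ n} (*≡* cross))
        (fromℚᵘ-homo-* (mkℚᵘ i 0) (mkℚᵘ 1ℤ n))
  where
  cross : i ℤ.* + suc (n ℕ.+ 0) ≡ (i ℤ.* 1ℤ) ℤ.* + suc n
  cross rewrite ℕ.+-identityʳ n = cong (ℤ._* + suc n) (sym (ℤ.*-identityʳ i))

[1+n]/1*1/[1+n]≡1 : ∀ n → (+ suc n) /1 * 1/[1+ n ] ≡ 1ℚ
[1+n]/1*1/[1+n]≡1 n =
  trans (sym (/suc≡/1*1/[1+] (+ suc n) n))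
        (fromℚᵘ-cong {mkℚᵘ (+ suc n) n} {mkℚᵘ 1ℤ 0} (*≡* (ℤ.*-comm (+ suc n) 1ℤ)))

cancel-[1+a] : ∀ q a j → q * ((+ suc a) /1 * 1/[1+ j ]) * 1/[1+ a ] ≡ q * 1/[1+ j ]
cancel-[1+a] q a j = begin
  q * ((+ suc a) /1 * 1/[1+ j ]) * 1/[1+ a ]   ≡⟨ regroup q ((+ suc a) /1) 1/[1+ j ] 1/[1+ a ] ⟩
  q * 1/[1+ j ] * ((+ suc a) /1 * 1/[1+ a ])   ≡⟨ cong (q * 1/[1+ j ] *_) ([1+n]/1*1/[1+n]≡1 a) ⟩
  q * 1/[1+ j ] * 1ℚ                         ≡⟨ ℚ.*-identityʳ (q * 1/[1+ j ]) ⟩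
  q * 1/[1+ j ]                              ∎
  where
  open ≡-Reasoning
  regroup : ∀ q u p r → q * (u * p) * r ≡ q * p * (u * r)
  regroup = solve-∀ ℚ-ring

Σ≤-cong : ∀ n {f g : ℕ → ℚ} → (∀ {k} → k ≤ n → f k ≡ g k) → Σ≤ n f ≡ Σ≤ n g
Σ≤-cong zero    f≡g = f≡g z≤n
Σ≤-cong (suc n) f≡g = cong₂ _+_ (Σ≤-cong n (λ k≤n → f≡g (ℕ.m≤n⇒m≤1+n k≤n))) (f≡g ℕ.≤-refl)

Σ≤-zero : ∀ n {f : ℕ → ℚ} → (∀ {k} → k ≤ n → f k ≡ 0ℚ) → Σ≤ n f ≡ 0ℚ
Σ≤-zero zero    f≡0 = f≡0 z≤n
Σ≤-zero (suc n) f≡0 = cong₂ _+_ (Σ≤-zero n (λ k≤n → f≡0 (ℕ.m≤n⇒m≤1+n k≤n))) (f≡0 ℕ.≤-refl)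

Σ≤-distrib-+ : ∀ n (f g : ℕ → ℚ) → Σ≤ n (λ k → f k + g k) ≡ Σ≤ n f + Σ≤ n g
Σ≤-distrib-+ zero    f g = refl
Σ≤-distrib-+ (suc n) f g =
  trans (cong (_+ (f (suc n) + g (suc n))) (Σ≤-distrib-+ n f g))
        (interchange (Σ≤ n f) (Σ≤ n g) (f (suc n)) (g (suc n)))
  where
  interchange : ∀ a b c d → (a + b) + (c + d) ≡ (a + c) + (b + d)
  interchange = solve-∀ ℚ-ring

infixl 7 _⋆_

_⋆_ : (ℕ → ℚ) → (ℕ → ℚ) → ℕ → ℚ
(f ⋆ g) n = Σ≤ n (λ k → f k * g (n ℕ.∸ k))

⋆-identityʳ : ∀ f {g} → g 0 ≡ 1ℚ → (∀ d → g (suc d) ≡ 0ℚ) → ∀ n → (f ⋆ g) n ≡ f n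
⋆-identityʳ f     g0≡1 g+≡0 zero    = trans (cong (f 0 *_) g0≡1) (ℚ.*-identityʳ (f 0))
⋆-identityʳ f {g} g0≡1 g+≡0 (suc n) = begin
  Σ≤ n (λ k → f k * g (suc n ℕ.∸ k)) + f (suc n) * g (n ℕ.∸ n)
    ≡⟨ cong₂ _+_ (Σ≤-zero n vanish) (cong (λ d → f (suc n) * g d) (ℕ.n∸n≡0 n)) ⟩
  0ℚ + f (suc n) * g 0
    ≡⟨ trans (ℚ.+-identityˡ (f (suc n) * g 0)) (cong (f (suc n) *_) g0≡1) ⟩
  f (suc n) * 1ℚ
    ≡⟨ ℚ.*-identityʳ (f (suc n)) ⟩
  f (suc n) ∎
  where
  open ≡-Reasoning
  vanish : ∀ {k} → k ≤ n → f k * g (suc n ℕ.∸ k) ≡ 0ℚ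
  vanish {k} k≤n = begin
    f k * g (suc n ℕ.∸ k)    ≡⟨ cong (λ d → f k * g d) (ℕ.+-∸-assoc 1 k≤n) ⟩
    f k * g (suc (n ℕ.∸ k))  ≡⟨ cong (f k *_) (g+≡0 (n ℕ.∸ k)) ⟩
    f k * 0ℚ                 ≡⟨ ℚ.*-zeroʳ (f k) ⟩
    0ℚ                       ∎

⋆-suc : ∀ f {g g′ g″} → g 0 ≡ g′ 0 → (∀ d → g (suc d) ≡ g′ (suc d) + g″ d) →
        ∀ n → (f ⋆ g) (suc n) ≡ (f ⋆ g′) (suc n) + (f ⋆ g″) n
⋆-suc f {g} {g′} {g″} g0≡g′0 g-rec n = begin
  Σ≤ n (λ k → f k * g (suc n ℕ.∸ k)) + f (suc n) * g (n ℕ.∸ n)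
    ≡⟨ cong₂ _+_ (Σ≤-cong n split) (cong (f (suc n) *_) last) ⟩
  Σ≤ n (λ k → f k * g′ (suc n ℕ.∸ k) + f k * g″ (n ℕ.∸ k)) + f (suc n) * g′ (n ℕ.∸ n)
    ≡⟨ cong (_+ f (suc n) * g′ (n ℕ.∸ n)) (Σ≤-distrib-+ n _ _) ⟩
  Σ≤ n (λ k → f k * g′ (suc n ℕ.∸ k)) + (f ⋆ g″) n + f (suc n) * g′ (n ℕ.∸ n)
    ≡⟨ swap (Σ≤ n (λ k → f k * g′ (suc n ℕ.∸ k))) ((f ⋆ g″) n) (f (suc n) * g′ (n ℕ.∸ n)) ⟩
  (f ⋆ g′) (suc n) + (f ⋆ g″) n ∎
  where
  open ≡-Reasoning
  swap : ∀ a b c → a + b + c ≡ a + c + b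
  swap = solve-∀ ℚ-ring
  last : g (n ℕ.∸ n) ≡ g′ (n ℕ.∸ n)
  last = subst (λ d → g d ≡ g′ d) (sym (ℕ.n∸n≡0 n)) g0≡g′0
  split : ∀ {k} → k ≤ n → f k * g (suc n ℕ.∸ k) ≡ f k * g′ (suc n ℕ.∸ k) + f k * g″ (n ℕ.∸ k)
  split {k} k≤n = begin
    f k * g (suc n ℕ.∸ k)
      ≡⟨ cong (λ d → f k * g d) (ℕ.+-∸-assoc 1 k≤n) ⟩
    f k * g (suc (n ℕ.∸ k))
      ≡⟨ cong (f k *_) (g-rec (n ℕ.∸ k)) ⟩
    f k * (g′ (suc (n ℕ.∸ k)) + g″ (n ℕ.∸ k))
      ≡⟨ ℚ.*-distribˡ-+ (f k) (g′ (suc (n ℕ.∸ k))) (g″ (n ℕ.∸ k)) ⟩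
    f k * g′ (suc (n ℕ.∸ k)) + f k * g″ (n ℕ.∸ k)
      ≡⟨ cong (λ d → f k * g′ d + f k * g″ (n ℕ.∸ k)) (ℕ.+-∸-assoc 1 k≤n) ⟨
    f k * g′ (suc n ℕ.∸ k) + f k * g″ (n ℕ.∸ k) ∎

module _ {a} {A : Set a} (_∙_ : A → A → A) where

  PascalRecurrence : (ℕ → ℕ → A) → Set a
  PascalRecurrence F = ∀ m n → F (suc m) (suc n) ≡ F m (suc n) ∙ F (suc m) n

  pascal-unique : ∀ {F G} → PascalRecurrence F → PascalRecurrence G →
                  (∀ m → F m 0 ≡ G m 0) → (∀ n → F 0 n ≡ G 0 n) → ∀ m n → F m n ≡ G m n
  pascal-unique         F-rec G-rec F≡G₀ F₀≡G m       zero    = F≡G₀ m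
  pascal-unique         F-rec G-rec F≡G₀ F₀≡G zero    (suc n) = F₀≡G (suc n)
  pascal-unique {F} {G} F-rec G-rec F≡G₀ F₀≡G (suc m) (suc n) = begin
    F (suc m) (suc n)         ≡⟨ F-rec m n ⟩
    F m (suc n) ∙ F (suc m) n ≡⟨ cong₂ _∙_ (F≡G m (suc n)) (F≡G (suc m) n) ⟩
    G m (suc n) ∙ G (suc m) n ≡⟨ G-rec m n ⟨
    G (suc m) (suc n)         ∎
    where
    open ≡-Reasoning
    F≡G : ∀ m n → F m n ≡ G m n
    F≡G = pascal-unique {F} {G} F-rec G-rec F≡G₀ F₀≡G

binom-suc : ∀ x j → binom x (suc j) ≡ binom x j * ((x - + j) /1 * 1/[1+ j ])
binom-suc x j = cong (binom x j *_) (/suc≡/1*1/[1+] (x - + j) j)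

binom-absorb : ∀ x j → binom (ℤ.suc x) (suc j) ≡ binom x j * (ℤ.suc x /1 * 1/[1+ j ])
binom-absorb x zero =
  trans (binom-suc (ℤ.suc x) 0) (cong (λ i → 1ℚ * (i /1 * 1/[1+ 0 ])) (ℤ.+-identityʳ (ℤ.suc x)))
binom-absorb x (suc j) = begin
  binom (ℤ.suc x) (suc (suc j))
    ≡⟨ binom-suc (ℤ.suc x) (suc j) ⟩
  binom (ℤ.suc x) (suc j) * ((ℤ.suc x - ℤ.suc (+ j)) /1 * 1/[1+ suc j ])
    ≡⟨ cong₂ (λ b i → b * (i /1 * 1/[1+ suc j ])) (binom-absorb x j) (suc-‿suc x (+ j)) ⟩
  binom x j * (ℤ.suc x /1 * 1/[1+ j ]) * ((x - + j) /1 * 1/[1+ suc j ])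
    ≡⟨ exchange (binom x j) (ℤ.suc x /1) 1/[1+ j ] ((x - + j) /1) 1/[1+ suc j ] ⟩
  binom x j * ((x - + j) /1 * 1/[1+ j ]) * (ℤ.suc x /1 * 1/[1+ suc j ])
    ≡⟨ cong (_* (ℤ.suc x /1 * 1/[1+ suc j ])) (binom-suc x j) ⟨
  binom x (suc j) * (ℤ.suc x /1 * 1/[1+ suc j ]) ∎
  where
  open ≡-Reasoning
  suc-‿suc : ∀ x y → (1ℤ ℤ.+ x) - (1ℤ ℤ.+ y) ≡ x - y
  suc-‿suc = ℤ-Solver.solve-∀
  exchange : ∀ b u p v q → b * (u * p) * (v * q) ≡ b * (v * p) * (u * q)
  exchange = solve-∀ ℚ-ring

binom-pascal : ∀ x j → binom (ℤ.suc x) (suc j) ≡ binom x (suc j) + binom x j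
binom-pascal x j = begin
  binom (ℤ.suc x) (suc j)
    ≡⟨ binom-absorb x j ⟩
  b * (ℤ.suc x /1 * 1/[1+ j ])
    ≡⟨ cong (λ i → b * (i /1 * 1/[1+ j ])) (split x (+ j)) ⟩
  b * (((x - + j) ℤ.+ + suc j) /1 * 1/[1+ j ])
    ≡⟨ cong (λ q → b * (q * 1/[1+ j ])) (/1-homo-+ (x - + j) (+ suc j)) ⟩
  b * (((x - + j) /1 + (+ suc j) /1) * 1/[1+ j ])
    ≡⟨ distrib b ((x - + j) /1) ((+ suc j) /1) 1/[1+ j ] ⟩
  b * ((x - + j) /1 * 1/[1+ j ]) + b * ((+ suc j) /1 * 1/[1+ j ])
    ≡⟨ cong₂ _+_ (sym (binom-suc x j)) (cong (b *_) ([1+n]/1*1/[1+n]≡1 j)) ⟩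
  binom x (suc j) + b * 1ℚ
    ≡⟨ cong (_+_ (binom x (suc j))) (ℚ.*-identityʳ b) ⟩
  binom x (suc j) + b ∎
  where
  open ≡-Reasoning
  b = binom x j
  split : ∀ x y → 1ℤ ℤ.+ x ≡ (x - y) ℤ.+ (1ℤ ℤ.+ y)
  split = ℤ-Solver.solve-∀
  distrib : ∀ b u v p → b * ((u + v) * p) ≡ b * (u * p) + b * (v * p)
  distrib = solve-∀ ℚ-ring

binom-diag : ∀ a → binom (+ a) a ≡ 1ℚ
binom-diag zero    = refl
binom-diag (suc a) =
  trans (binom-absorb (+ a) a) (cong₂ _*_ (binom-diag a) ([1+n]/1*1/[1+n]≡1 a))

binom-suc-diag : ∀ a → binom (+ a) (suc a) ≡ 0ℚ
binom-suc-diag a = begin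
  binom (+ a) (suc a)
    ≡⟨ binom-suc (+ a) a ⟩
  binom (+ a) a * ((+ a - + a) /1 * 1/[1+ a ])
    ≡⟨ cong (λ i → binom (+ a) a * (i /1 * 1/[1+ a ])) (ℤ.+-inverseʳ (+ a)) ⟩
  binom (+ a) a * (0ℚ * 1/[1+ a ])
    ≡⟨ cong (binom (+ a) a *_) (ℚ.*-zeroˡ 1/[1+ a ]) ⟩
  binom (+ a) a * 0ℚ
    ≡⟨ ℚ.*-zeroʳ (binom (+ a) a) ⟩
  0ℚ ∎
  where open ≡-Reasoning

binom-sym : ∀ a b → binom (+ (a ℕ.+ b)) a ≡ binom (+ (a ℕ.+ b)) b
binom-sym zero    b       = sym (binom-diag b)
binom-sym (suc a) zero    =
  trans (cong (λ n → binom (+ n) (suc a)) (ℕ.+-identityʳ (suc a))) (binom-diag (suc a))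
binom-sym (suc a) (suc b) = begin
  binom (ℤ.suc x) (suc a)       ≡⟨ binom-pascal x a ⟩
  binom x (suc a) + binom x a   ≡⟨ cong₂ _+_ shifted (binom-sym a (suc b)) ⟩
  binom x b + binom x (suc b)   ≡⟨ ℚ.+-comm (binom x b) (binom x (suc b)) ⟩
  binom x (suc b) + binom x b   ≡⟨ binom-pascal x b ⟨
  binom (ℤ.suc x) (suc b)       ∎
  where
  open ≡-Reasoning
  x = + (a ℕ.+ suc b)
  shifted : binom x (suc a) ≡ binom x b
  shifted = subst (λ n → binom (+ n) (suc a) ≡ binom (+ n) b) (sym (ℕ.+-suc a b))
                  (binom-sym (suc a) b)

binom-absorb-1/[1+] : ∀ a j → binom (+ suc a) (suc j) * 1/[1+ a ] ≡ binom (+ a) j * 1/[1+ j ]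
binom-absorb-1/[1+] a j =
  trans (cong (_* 1/[1+ a ]) (binom-absorb (+ a) j)) (cancel-[1+a] (binom (+ a) j) a j)

binom-suc-1/[1+] : ∀ b j →
  binom (+ (b ℕ.+ suc j)) (suc j) * 1/[1+ b ] ≡ binom (+ (b ℕ.+ suc j)) j * 1/[1+ j ]
binom-suc-1/[1+] b j = begin
  binom x (suc j) * 1/[1+ b ]
    ≡⟨ cong (_* 1/[1+ b ]) (binom-suc x j) ⟩
  binom x j * ((x - + j) /1 * 1/[1+ j ]) * 1/[1+ b ]
    ≡⟨ cong (λ i → binom x j * (i /1 * 1/[1+ j ]) * 1/[1+ b ]) x-j≡1+b ⟩
  binom x j * ((+ suc b) /1 * 1/[1+ j ]) * 1/[1+ b ]
    ≡⟨ cancel-[1+a] (binom x j) b j ⟩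
  binom x j * 1/[1+ j ] ∎
  where
  open ≡-Reasoning
  x = + (b ℕ.+ suc j)
  shift : ∀ b j → (b ℤ.+ (1ℤ ℤ.+ j)) - j ≡ 1ℤ ℤ.+ b
  shift = ℤ-Solver.solve-∀
  x-j≡1+b : x - + j ≡ + suc b
  x-j≡1+b = trans (cong (_- + j) (ℤ.pos-+ b (suc j))) (shift (+ b) (+ j))

multichoose : ℕ → ℕ → ℚ
multichoose m d = binom (+ (m ℕ.+ d) - 1ℤ) d

multichoose-pascal : ∀ m d →
  multichoose (suc m) (suc d) ≡ multichoose m (suc d) + multichoose (suc m) d
multichoose-pascal m d = begin
  binom (+ suc y - 1ℤ) (suc d)
    ≡⟨ cong (λ x → binom x (suc d)) (suc-pred-comm (+ y)) ⟩
  binom (ℤ.suc (+ y - 1ℤ)) (suc d)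
    ≡⟨ binom-pascal (+ y - 1ℤ) d ⟩
  binom (+ y - 1ℤ) (suc d) + binom (+ y - 1ℤ) d
    ≡⟨ cong (λ j → multichoose m (suc d) + binom (+ j - 1ℤ) d) (ℕ.+-suc m d) ⟩
  multichoose m (suc d) + multichoose (suc m) d ∎
  where
  open ≡-Reasoning
  y = m ℕ.+ suc d
  suc-pred-comm : ∀ x → (1ℤ ℤ.+ x) - 1ℤ ≡ 1ℤ ℤ.+ (x - 1ℤ)
  suc-pred-comm = ℤ-Solver.solve-∀

multichoose-zero-suc : ∀ d → multichoose 0 (suc d) ≡ 0ℚ
multichoose-zero-suc d =
  trans (cong (λ x → binom x (suc d)) (suc-pred (+ d))) (binom-suc-diag d)
  where
  suc-pred : ∀ x → (1ℤ ℤ.+ x) - 1ℤ ≡ x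
  suc-pred = ℤ-Solver.solve-∀

binom≡multichoose : ∀ m {n k} → k ≤ n →
  binom (+ (m ℕ.+ n) - + k - 1ℤ) (n ℕ.∸ k) ≡ multichoose m (n ℕ.∸ k)
binom≡multichoose m {n} {k} k≤n = cong (λ x → binom (x - 1ℤ) (n ℕ.∸ k)) (begin
  + (m ℕ.+ n) - + k    ≡⟨ ℤ.[+m]-[+n]≡m⊖n (m ℕ.+ n) k ⟩
  (m ℕ.+ n) ℤ.⊖ k      ≡⟨ ℤ.⊖-≥ (ℕ.≤-trans k≤n (ℕ.m≤n+m n m)) ⟩
  + (m ℕ.+ n ℕ.∸ k)    ≡⟨ cong +_ (ℕ.+-∸-assoc m k≤n) ⟩
  + (m ℕ.+ (n ℕ.∸ k))  ∎)
  where open ≡-Reasoning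

harmonicGap : ℕ → ℕ → ℚ
harmonicGap m n = binom (+ (m ℕ.+ n)) n * (H (m ℕ.+ n) ℚ.- H m)

harmonicGap-zeroʳ : ∀ m → harmonicGap m 0 ≡ 0ℚ
harmonicGap-zeroʳ m = begin
  1ℚ * (H (m ℕ.+ 0) ℚ.- H m)  ≡⟨ cong (λ j → 1ℚ * (H j ℚ.- H m)) (ℕ.+-identityʳ m) ⟩
  1ℚ * (H m ℚ.- H m)          ≡⟨ ℚ.*-identityˡ (H m ℚ.- H m) ⟩
  H m ℚ.- H m                 ≡⟨ ℚ.+-inverseʳ (H m) ⟩
  0ℚ                          ∎
  where open ≡-Reasoning

harmonicGap-zeroˡ : ∀ n → harmonicGap 0 n ≡ H n
harmonicGap-zeroˡ n = trans (cong (_* (H n ℚ.- 0ℚ)) (binom-diag n)) (simplify (H n))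
  where
  simplify : ∀ h → 1ℚ * (h ℚ.- 0ℚ) ≡ h
  simplify = solve-∀ ℚ-ring

harmonicGap-pascal : PascalRecurrence _+_ harmonicGap
harmonicGap-pascal m n = begin
  binom (ℤ.suc x) (suc n) * (H y + 1/[1+ y ] ℚ.- (H m + 1/[1+ m ]))
    ≡⟨ cong (_* (H y + 1/[1+ y ] ℚ.- (H m + 1/[1+ m ]))) (binom-pascal x n) ⟩
  (b₁ + b₀) * (H y + 1/[1+ y ] ℚ.- (H m + 1/[1+ m ]))
    ≡⟨ regroup b₁ b₀ (H y) 1/[1+ y ] (H m) 1/[1+ m ] ⟩
  rest + ((b₁ + b₀) * 1/[1+ y ] ℚ.- b₁ * 1/[1+ m ])
    ≡⟨ cong (λ q → rest + (q ℚ.- b₁ * 1/[1+ m ])) key ⟩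
  rest + (b₁ * 1/[1+ m ] ℚ.- b₁ * 1/[1+ m ])
    ≡⟨ trans (cong (_+_ rest) (ℚ.+-inverseʳ (b₁ * 1/[1+ m ]))) (ℚ.+-identityʳ rest) ⟩
  b₁ * (H y ℚ.- H m) + b₀ * (H y ℚ.- (H m + 1/[1+ m ]))
    ≡⟨ cong (λ j → b₁ * (H y ℚ.- H m) + binom (+ j) n * (H j ℚ.- (H m + 1/[1+ m ]))) (ℕ.+-suc m n) ⟩
  harmonicGap m (suc n) + harmonicGap (suc m) n ∎
  where
  open ≡-Reasoning
  y = m ℕ.+ suc n
  x = + y
  b₁ = binom x (suc n)
  b₀ = binom x n
  rest = b₁ * (H y ℚ.- H m) + b₀ * (H y ℚ.- (H m + 1/[1+ m ]))
  regroup : ∀ b₁ b₀ h p g q → (b₁ + b₀) * (h + p ℚ.- (g + q))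
            ≡ b₁ * (h ℚ.- g) + b₀ * (h ℚ.- (g + q)) + ((b₁ + b₀) * p ℚ.- b₁ * q)
  regroup = solve-∀ ℚ-ring
  key : (b₁ + b₀) * 1/[1+ y ] ≡ b₁ * 1/[1+ m ]
  key = begin
    (b₁ + b₀) * 1/[1+ y ]               ≡⟨ cong (_* 1/[1+ y ]) (binom-pascal x n) ⟨
    binom (+ suc y) (suc n) * 1/[1+ y ] ≡⟨ binom-absorb-1/[1+] y n ⟩
    b₀ * 1/[1+ n ]                      ≡⟨ binom-suc-1/[1+] m n ⟨
    b₁ * 1/[1+ m ]                      ∎

harmonicGap≡H⋆multichoose : ∀ m n → harmonicGap m n ≡ (H ⋆ multichoose m) n
harmonicGap≡H⋆multichoose = pascal-unique _+_ harmonicGap-pascal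
  (λ m → ⋆-suc H {multichoose (suc m)} {multichoose m} refl (multichoose-pascal m))
  harmonicGap-zeroʳ
  (λ n → trans (harmonicGap-zeroˡ n)
                (sym (⋆-identityʳ H {multichoose 0} refl multichoose-zero-suc n)))

theorem2p2 : (m n : ℕ) →
    binom (+ (m Data.Nat.+ n)) m * H (n Data.Nat.+ m)
      ≡ Σ≤ n (λ k → H k * binom (+ (m Data.Nat.+ n) - + k - + 1) (n Data.Nat.∸ k))
        + H m * binom (+ (n Data.Nat.+ m)) n
theorem2p2 m n = begin
  binom (+ (m ℕ.+ n)) m * H (n ℕ.+ m)
    ≡⟨ cong₂ _*_ (binom-sym m n) (cong H (ℕ.+-comm n m)) ⟩
  b * H (m ℕ.+ n)
    ≡⟨ split b (H (m ℕ.+ n)) (H m) ⟩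
  harmonicGap m n + H m * b
    ≡⟨ cong₂ _+_ (harmonicGap≡H⋆multichoose m n) (cong (λ j → H m * binom (+ j) n) (ℕ.+-comm m n)) ⟩
  (H ⋆ multichoose m) n + H m * binom (+ (n ℕ.+ m)) n
    ≡⟨ cong (_+ H m * binom (+ (n ℕ.+ m)) n) (Σ≤-cong n summand) ⟨
  Σ≤ n (λ k → H k * binom (+ (m ℕ.+ n) - + k - + 1) (n ℕ.∸ k)) + H m * binom (+ (n ℕ.+ m)) n ∎
  where
  open ≡-Reasoning
  b = binom (+ (m ℕ.+ n)) n
  summand : ∀ {k} → k ≤ n →
            H k * binom (+ (m ℕ.+ n) - + k - + 1) (n ℕ.∸ k) ≡ H k * multichoose m (n ℕ.∸ k)
  summand {k} k≤n = cong (H k *_) (binom≡multichoose m k≤n)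
  split : ∀ b h g → b * h ≡ b * (h ℚ.- g) + g * b
  split = solve-∀ ℚ-ring
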